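{- Let $\mathbb{F}_q$ be a finite field, $P,Q\in\mathbb{F}_q[X]\setminus\{0\}$ coprime with $\deg P>\deg Q$ and $\deg Q\ge 1$, $\mathcal{D}=\{s\in\mathbb{F}_q[X]:\deg s<\deg P\}$, and let $W_{P/Q}$ be the $\omega$-language of the expansion graph $T(P/Q)$. Then the only eventually periodic element of $W_{P/Q}$ is $0^\omega=000\cdots$.
   Context: The expansion graph $T(P/Q)$ is the edge-labelled directed graph with vertex set $\mathbb{F}_q[X]$ in which there is an edge from $v$ to $w$ with label $s\in\mathcal{D}$ whenever $w=(Pv+s)/Q\in\mathbb{F}_q[X]$. $W_{P/Q}$ is the set of right-infinite words over $\mathcal{D}$ that are label sequences of infinite directed paths in $T(P/Q)$ starting at the vertex $0$. -}

module Defs where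

open import Level using (Level; _⊔_) renaming (suc to lsuc)
open import Algebra.Bundles using (CommutativeRing)
open import Data.Nat using (ℕ; zero; suc; _+_; _<_; _≤_)
open import Data.Fin using (Fin)
open import Data.List using (List; []; _∷_)
open import Data.Product using (Σ; ∃; _×_; _,_)
open import Relation.Binary.PropositionalEquality using (_≡_)
open import Relation.Nullary using (¬_)

record FiniteField (c ℓ : Level) : Set (lsuc (c ⊔ ℓ)) where
  field
    commRing : CommutativeRing c ℓ
  open CommutativeRing commRing public hiding (ring)
  field
    1≉0     : ¬ (1# ≈ 0#)
    inverse : ∀ x → ¬ (x ≈ 0#) → ∃ λ y → x * y ≈ 1#
    q       : ℕ
    enum    : Fin q → Carrier
    enum-surj : ∀ x → ∃ λ i → enum i ≈ x
    enum-inj  : ∀ i j → enum i ≈ enum j → i ≡ j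

-- Polynomials over a finite field F, as coefficient lists (lowest degree
-- first); equality is coefficientwise equality (trailing zeros ignored).
module Poly {c ℓ} (F : FiniteField c ℓ) where
  open FiniteField F renaming (_+_ to _+F_; _*_ to _*F_)

  Pol : Set c
  Pol = List Carrier

  coeff : Pol → ℕ → Carrier
  coeff []       _       = 0#
  coeff (a ∷ p)  zero    = a
  coeff (a ∷ p)  (suc i) = coeff p i

  infix 4 _≃_
  _≃_ : Pol → Pol → Set ℓ
  p ≃ r = ∀ i → coeff p i ≈ coeff r i

  0ₚ : Pol
  0ₚ = []

  1ₚ : Pol
  1ₚ = 1# ∷ []

  infixl 6 _⊕_
  _⊕_ : Pol → Pol → Pol
  []      ⊕ r       = r
  (a ∷ p) ⊕ []      = a ∷ p
  (a ∷ p) ⊕ (b ∷ r) = (a +F b) ∷ (p ⊕ r)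

  scale : Carrier → Pol → Pol
  scale a []      = []
  scale a (b ∷ p) = (a *F b) ∷ scale a p

  infixl 7 _⊗_
  _⊗_ : Pol → Pol → Pol
  []      ⊗ r = []
  (a ∷ p) ⊗ r = scale a r ⊕ (0# ∷ (p ⊗ r))

  HasDegree : Pol → ℕ → Set ℓ
  HasDegree p d = ¬ (coeff p d ≈ 0#) × (∀ i → d < i → coeff p i ≈ 0#)

  -- deg s < n  (with deg 0 = -∞, so 0 satisfies this for every n)
  DegLt : Pol → ℕ → Set ℓ
  DegLt s n = ∀ i → n ≤ i → coeff s i ≈ 0#

  _∣ₚ_ : Pol → Pol → Set (c ⊔ ℓ)
  d ∣ₚ p = ∃ λ r → d ⊗ r ≃ p

  -- P and Q coprime: every common divisor is a unit (nonzero constant)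
  Coprime : Pol → Pol → Set (c ⊔ ℓ)
  Coprime P Q = ∀ D → D ∣ₚ P → D ∣ₚ Q → HasDegree D 0

  Digit : ℕ → Pol → Set ℓ
  Digit dP s = DegLt s dP

  -- w ∈ W_{P/Q} (dP = deg P): w is a word over 𝒟 which is the label
  -- sequence of an infinite path v₀ = 0 → v₁ → v₂ → … in T(P/Q), where
  -- there is an edge v → v' labelled s iff v' = (P v + s)/Q ∈ F[X],
  -- i.e. Q v' = P v + s.
  InW : (P Q : Pol) (dP : ℕ) → (ℕ → Pol) → Set (c ⊔ ℓ)
  InW P Q dP w =
    (∀ n → Digit dP (w n)) ×
    (∃ λ (v : ℕ → Pol) → (v 0 ≃ 0ₚ) × (∀ n → Q ⊗ v (suc n) ≃ P ⊗ v n ⊕ w n))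

  EventuallyPeriodic : (ℕ → Pol) → Set ℓ
  EventuallyPeriodic w =
    ∃ λ N → ∃ λ p → 0 < p × (∀ n → N ≤ n → w (n + p) ≃ w n)

  IsZeroWord : (ℕ → Pol) → Set ℓ
  IsZeroWord w = ∀ n → w n ≃ 0ₚ

module Submission where

-- Let v₀ → v₁ → … be a path in T(P/Q) with labels wₙ, i.e.
-- Q·vₙ₊₁ = P·vₙ + wₙ with deg wₙ < deg P.  The proof has three ingredients.
--
-- * Growth.  Since deg Q < deg P and the digits are small, comparing
--   degrees in Q·vₙ₊₁ = P·vₙ + wₙ shows that a nonzero vertex is followed
--   only by nonzero vertices of strictly larger degree.
-- * Descent.  If Q·eₘ₊₁ = P·eₘ for all m, then Q ∣ P·eₘ, hence Q ∣ eₘ by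
--   coprimality (Bézout), and the quotients satisfy the same recurrence with
--   smaller degrees (deg Q ≥ 1); by induction on a degree bound, e₀ = 0.
-- * If the labels are p-periodic from N on, then for M ≥ N the differences
--   eₘ = v_{p+M+m} − v_{M+m} satisfy the homogeneous recurrence, so
--   v_{p+M} = v_M; by growth v_M = 0.  By growth again every vₙ = 0, and then
--   every digit wₙ = Q·vₙ₊₁ − P·vₙ is 0.

open import Defs
open import Level using (_⊔_)
open import Algebra.Bundles using (CommutativeRing)
import Algebra.Properties.Ring as RingProperties
import Algebra.Properties.CommutativeSemigroup as CommutativeSemigroupProperties
open import Data.Nat using (ℕ; zero; suc; _+_; _<_; _≤_; _≤?_; z≤n; s≤s)
import Data.Nat.Properties as ℕ
import Data.Fin as Fin
open import Data.List using ([]; _∷_; length; map)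
open import Data.Product using (Σ; ∃; _×_; _,_; proj₁; proj₂)
open import Data.Sum using (_⊎_; inj₁; inj₂)
open import Data.Empty using (⊥-elim)
open import Relation.Nullary using (¬_; Dec; yes; no)
import Relation.Binary.PropositionalEquality as ≡
open import Relation.Binary.Structures using (IsEquivalence)
open import Relation.Binary.Bundles using (Setoid)
open import Relation.Binary.Definitions using (tri<; tri≈; tri>)
import Relation.Binary.Reasoning.Setoid as SetoidReasoning

module Polynomials {c ℓ} (F : FiniteField c ℓ) where
  open Poly F public
  open FiniteField F hiding (q) renaming (_+_ to _+F_; _*_ to _*F_; _-_ to _-F_)
  open RingProperties (CommutativeRing.ring commRing)
    using (-0#≈0#; x∙y⁻¹≈ε⇒x≈y; x≈y⇒x∙y⁻¹≈ε)
  open CommutativeSemigroupProperties +-commutativeSemigroup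
    using (interchange; x∙yz≈y∙xz)
  module ≈-Reasoning = SetoidReasoning setoid

  -- Finiteness of F makes "x ≈ 0" decidable (compare enumeration indices).
  ≈0? : ∀ x → Dec (x ≈ 0#)
  ≈0? x with enum-surj x | enum-surj 0#
  ... | i , eᵢ | j , eⱼ with i Fin.≟ j
  ... | yes ≡.refl = yes (trans (sym eᵢ) eⱼ)
  ... | no i≢j = no λ x≈0 → i≢j (enum-inj i j (trans eᵢ (trans x≈0 (sym eⱼ))))

  -- A field has no zero divisors; this makes degrees add under products.
  *-nonzero : ∀ {x y} → ¬ (x ≈ 0#) → ¬ (y ≈ 0#) → ¬ (x *F y ≈ 0#)
  *-nonzero {x} {y} x≉0 y≉0 xy≈0 with inverse x x≉0
  ... | x⁻¹ , xx⁻¹≈1 = y≉0 (begin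
      y                 ≈⟨ *-identityˡ y ⟨
      1# *F y           ≈⟨ *-cong (trans (sym xx⁻¹≈1) (*-comm x x⁻¹)) refl ⟩
      (x⁻¹ *F x) *F y   ≈⟨ *-assoc x⁻¹ x y ⟩
      x⁻¹ *F (x *F y)   ≈⟨ *-cong refl xy≈0 ⟩
      x⁻¹ *F 0#         ≈⟨ zeroʳ x⁻¹ ⟩
      0#                ∎)
    where open ≈-Reasoning

  -- Coefficientwise equality, wrapped in a record so that the two
  -- polynomials can be inferred from a proof.
  infix 4 _≅_
  record _≅_ (p r : Pol) : Set ℓ where
    constructor coeffwise
    field coeff≈ : p ≃ r
  open _≅_ public

  ≅-isEquivalence : IsEquivalence _≅_
  ≅-isEquivalence = record
    { refl  = coeffwise λ i → refl
    ; sym   = λ (coeffwise h) → coeffwise λ i → sym (h i)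
    ; trans = λ (coeffwise h) (coeffwise g) → coeffwise λ i → trans (h i) (g i) }

  ≅-setoid : Setoid c ℓ
  ≅-setoid = record { isEquivalence = ≅-isEquivalence }

  open IsEquivalence ≅-isEquivalence public
    using () renaming (refl to ≅-refl; sym to ≅-sym; trans to ≅-trans; reflexive to ≅-reflexive)
  module ≅-Reasoning = SetoidReasoning ≅-setoid

  neg : Pol → Pol
  neg = map -_

  infixl 6 _⊖_
  _⊖_ : Pol → Pol → Pol
  p ⊖ r = p ⊕ neg r

  coeff-⊕ : ∀ p r i → coeff (p ⊕ r) i ≈ coeff p i +F coeff r i
  coeff-⊕ []      r       i       = sym (+-identityˡ _)
  coeff-⊕ (a ∷ p) []      i       = sym (+-identityʳ _)
  coeff-⊕ (a ∷ p) (b ∷ r) zero    = refl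
  coeff-⊕ (a ∷ p) (b ∷ r) (suc i) = coeff-⊕ p r i

  coeff-scale : ∀ a p i → coeff (scale a p) i ≈ a *F coeff p i
  coeff-scale a []      i       = sym (zeroʳ a)
  coeff-scale a (b ∷ p) zero    = refl
  coeff-scale a (b ∷ p) (suc i) = coeff-scale a p i

  coeff-neg : ∀ p i → coeff (neg p) i ≈ - coeff p i
  coeff-neg []      i       = sym -0#≈0#
  coeff-neg (a ∷ p) zero    = refl
  coeff-neg (a ∷ p) (suc i) = coeff-neg p i

  coeff-⊖ : ∀ p r i → coeff (p ⊖ r) i ≈ coeff p i -F coeff r i
  coeff-⊖ p r i = trans (coeff-⊕ p (neg r) i) (+-cong refl (coeff-neg r i))

  coeff-⊗-∷ : ∀ a p r i → coeff ((a ∷ p) ⊗ r) i ≈ a *F coeff r i +F coeff (0# ∷ (p ⊗ r)) i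
  coeff-⊗-∷ a p r i = trans (coeff-⊕ (scale a r) (0# ∷ (p ⊗ r)) i) (+-cong (coeff-scale a r i) refl)

  ⊕-cong : ∀ {p p' r r'} → p ≅ p' → r ≅ r' → p ⊕ r ≅ p' ⊕ r'
  ⊕-cong {p} {p'} {r} {r'} (coeffwise h) (coeffwise g) = coeffwise λ i →
    trans (coeff-⊕ p r i) (trans (+-cong (h i) (g i)) (sym (coeff-⊕ p' r' i)))

  ⊕-congˡ : ∀ p {r r'} → r ≅ r' → p ⊕ r ≅ p ⊕ r'
  ⊕-congˡ p = ⊕-cong (≅-refl {p})

  ⊕-congʳ : ∀ r {p p'} → p ≅ p' → p ⊕ r ≅ p' ⊕ r
  ⊕-congʳ r p≅p' = ⊕-cong p≅p' (≅-refl {r})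

  neg-cong : ∀ {p p'} → p ≅ p' → neg p ≅ neg p'
  neg-cong {p} {p'} (coeffwise h) = coeffwise λ i →
    trans (coeff-neg p i) (trans (-‿cong (h i)) (sym (coeff-neg p' i)))

  scale-cong : ∀ {a b p p'} → a ≈ b → p ≅ p' → scale a p ≅ scale b p'
  scale-cong {a} {b} {p} {p'} a≈b (coeffwise h) = coeffwise λ i →
    trans (coeff-scale a p i) (trans (*-cong a≈b (h i)) (sym (coeff-scale b p' i)))

  ∷-cong : ∀ {a b p p'} → a ≈ b → p ≅ p' → (a ∷ p) ≅ (b ∷ p')
  ∷-cong a≈b (coeffwise h) = coeffwise λ { zero → a≈b ; (suc i) → h i }

  ⊕-assoc : ∀ p r s → (p ⊕ r) ⊕ s ≅ p ⊕ (r ⊕ s)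
  ⊕-assoc p r s = coeffwise λ i → begin
    coeff ((p ⊕ r) ⊕ s) i                   ≈⟨ trans (coeff-⊕ (p ⊕ r) s i) (+-cong (coeff-⊕ p r i) refl) ⟩
    (coeff p i +F coeff r i) +F coeff s i   ≈⟨ +-assoc _ _ _ ⟩
    coeff p i +F (coeff r i +F coeff s i)   ≈⟨ trans (coeff-⊕ p (r ⊕ s) i) (+-cong refl (coeff-⊕ r s i)) ⟨
    coeff (p ⊕ (r ⊕ s)) i                   ∎
    where open ≈-Reasoning

  ⊕-comm : ∀ p r → p ⊕ r ≅ r ⊕ p
  ⊕-comm p r = coeffwise λ i →
    trans (coeff-⊕ p r i) (trans (+-comm _ _) (sym (coeff-⊕ r p i)))

  ⊕-identityʳ : ∀ p → p ⊕ [] ≅ p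
  ⊕-identityʳ p = coeffwise λ i → trans (coeff-⊕ p [] i) (+-identityʳ _)

  ⊕-inverseˡ : ∀ p → neg p ⊕ p ≅ []
  ⊕-inverseˡ p = coeffwise λ i →
    trans (coeff-⊕ (neg p) p i) (trans (+-cong (coeff-neg p i) refl) (-‿inverseˡ _))

  ⊕-inverseʳ : ∀ p → p ⊕ neg p ≅ []
  ⊕-inverseʳ p = ≅-trans (⊕-comm p (neg p)) (⊕-inverseˡ p)

  ⊗-zeroˡ : ∀ p r → p ≅ [] → p ⊗ r ≅ []
  ⊗-zeroˡ []      r p≅0 = ≅-refl
  ⊗-zeroˡ (a ∷ p) r (coeffwise h) = coeffwise λ i →
    trans (coeff-⊗-∷ a p r i)
      (trans (+-cong (trans (*-cong (h 0) refl) (zeroˡ _)) (shifted i)) (+-identityˡ 0#))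
    where
    shifted : ∀ i → coeff (0# ∷ (p ⊗ r)) i ≈ 0#
    shifted zero    = refl
    shifted (suc i) = coeff≈ (⊗-zeroˡ p r (coeffwise λ j → h (suc j))) i

  ⊗-annihilʳ : ∀ p → p ⊗ [] ≅ []
  ⊗-annihilʳ []      = ≅-refl
  ⊗-annihilʳ (a ∷ p) =
    ≅-trans (∷-cong refl (⊗-annihilʳ p)) (coeffwise λ { zero → refl ; (suc i) → refl })

  ⊗-congʳ : ∀ p {r r'} → r ≅ r' → p ⊗ r ≅ p ⊗ r'
  ⊗-congʳ []      r≅r' = ≅-refl
  ⊗-congʳ (a ∷ p) r≅r' = ⊕-cong (scale-cong refl r≅r') (∷-cong refl (⊗-congʳ p r≅r'))

  ⊗-congˡ : ∀ {p p'} r → p ≅ p' → p ⊗ r ≅ p' ⊗ r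
  ⊗-congˡ {[]}    {[]}     r p≅p' = ≅-refl
  ⊗-congˡ {[]}    {b ∷ p'} r p≅p' = ≅-sym (⊗-zeroˡ (b ∷ p') r (≅-sym p≅p'))
  ⊗-congˡ {a ∷ p} {[]}     r p≅p' = ⊗-zeroˡ (a ∷ p) r p≅p'
  ⊗-congˡ {a ∷ p} {b ∷ p'} r (coeffwise h) =
    ⊕-cong (scale-cong (h 0) ≅-refl) (∷-cong refl (⊗-congˡ {p} {p'} r (coeffwise λ i → h (suc i))))

  ⊗-cong : ∀ {p p' r r'} → p ≅ p' → r ≅ r' → p ⊗ r ≅ p' ⊗ r'
  ⊗-cong {p' = p'} {r = r} p≅p' r≅r' = ≅-trans (⊗-congˡ r p≅p') (⊗-congʳ p' r≅r')

  ⊗-distribʳ : ∀ p q r → (p ⊕ q) ⊗ r ≅ p ⊗ r ⊕ q ⊗ r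
  ⊗-distribʳ []      q       r = ≅-refl
  ⊗-distribʳ (a ∷ p) []      r = ≅-sym (⊕-identityʳ _)
  ⊗-distribʳ (a ∷ p) (b ∷ q) r = coeffwise λ i → begin
    coeff (((a +F b) ∷ (p ⊕ q)) ⊗ r) i
      ≈⟨ coeff-⊗-∷ (a +F b) (p ⊕ q) r i ⟩
    (a +F b) *F coeff r i +F coeff (0# ∷ ((p ⊕ q) ⊗ r)) i
      ≈⟨ +-cong (distribʳ (coeff r i) a b) (shifted i) ⟩
    (a *F coeff r i +F b *F coeff r i) +F (coeff (0# ∷ (p ⊗ r)) i +F coeff (0# ∷ (q ⊗ r)) i)
      ≈⟨ interchange _ _ _ _ ⟩
    (a *F coeff r i +F coeff (0# ∷ (p ⊗ r)) i) +F (b *F coeff r i +F coeff (0# ∷ (q ⊗ r)) i)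
      ≈⟨ +-cong (coeff-⊗-∷ a p r i) (coeff-⊗-∷ b q r i) ⟨
    coeff ((a ∷ p) ⊗ r) i +F coeff ((b ∷ q) ⊗ r) i
      ≈⟨ coeff-⊕ ((a ∷ p) ⊗ r) ((b ∷ q) ⊗ r) i ⟨
    coeff ((a ∷ p) ⊗ r ⊕ (b ∷ q) ⊗ r) i ∎
    where
    open ≈-Reasoning
    shifted : ∀ i → coeff (0# ∷ ((p ⊕ q) ⊗ r)) i ≈ coeff (0# ∷ (p ⊗ r)) i +F coeff (0# ∷ (q ⊗ r)) i
    shifted zero    = sym (+-identityˡ 0#)
    shifted (suc i) = trans (coeff≈ (⊗-distribʳ p q r) i) (coeff-⊕ (p ⊗ r) (q ⊗ r) i)

  ⊗-∷ʳ : ∀ r a p → r ⊗ (a ∷ p) ≅ scale a r ⊕ (0# ∷ (r ⊗ p))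
  ⊗-∷ʳ []      a p = coeffwise λ { zero → refl ; (suc i) → refl }
  ⊗-∷ʳ (b ∷ r) a p = coeffwise λ
    { zero    → +-cong (*-comm b a) refl
    ; (suc i) → begin
        coeff (scale b p ⊕ (r ⊗ (a ∷ p))) i
          ≈⟨ coeff-⊕ (scale b p) _ i ⟩
        coeff (scale b p) i +F coeff (r ⊗ (a ∷ p)) i
          ≈⟨ +-cong refl (trans (coeff≈ (⊗-∷ʳ r a p) i) (coeff-⊕ (scale a r) _ i)) ⟩
        coeff (scale b p) i +F (coeff (scale a r) i +F coeff (0# ∷ (r ⊗ p)) i)
          ≈⟨ x∙yz≈y∙xz _ _ _ ⟩
        coeff (scale a r) i +F (coeff (scale b p) i +F coeff (0# ∷ (r ⊗ p)) i)
          ≈⟨ trans (coeff-⊕ (scale a r) _ i) (+-cong refl (coeff-⊕ (scale b p) _ i)) ⟨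
        coeff (scale a r ⊕ (scale b p ⊕ (0# ∷ (r ⊗ p)))) i ∎ }
    where open ≈-Reasoning

  ⊗-comm : ∀ p r → p ⊗ r ≅ r ⊗ p
  ⊗-comm []      r = ≅-sym (⊗-annihilʳ r)
  ⊗-comm (a ∷ p) r = ≅-trans (⊕-congˡ (scale a r) (∷-cong refl (⊗-comm p r))) (≅-sym (⊗-∷ʳ r a p))

  scale-⊗ : ∀ a r s → scale a r ⊗ s ≅ scale a (r ⊗ s)
  scale-⊗ a []      s = ≅-refl
  scale-⊗ a (b ∷ r) s = coeffwise λ i → begin
    coeff ((a *F b ∷ scale a r) ⊗ s) i
      ≈⟨ coeff-⊗-∷ (a *F b) (scale a r) s i ⟩
    (a *F b) *F coeff s i +F coeff (0# ∷ (scale a r ⊗ s)) i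
      ≈⟨ +-cong (*-assoc a b _) (shifted i) ⟩
    a *F (b *F coeff s i) +F a *F coeff (0# ∷ (r ⊗ s)) i
      ≈⟨ distribˡ a _ _ ⟨
    a *F (b *F coeff s i +F coeff (0# ∷ (r ⊗ s)) i)
      ≈⟨ trans (coeff-scale a ((b ∷ r) ⊗ s) i) (*-cong refl (coeff-⊗-∷ b r s i)) ⟨
    coeff (scale a ((b ∷ r) ⊗ s)) i ∎
    where
    open ≈-Reasoning
    shifted : ∀ i → coeff (0# ∷ (scale a r ⊗ s)) i ≈ a *F coeff (0# ∷ (r ⊗ s)) i
    shifted zero    = sym (zeroʳ a)
    shifted (suc i) = trans (coeff≈ (scale-⊗ a r s) i) (coeff-scale a (r ⊗ s) i)

  X·-⊗ : ∀ t s → (0# ∷ t) ⊗ s ≅ (0# ∷ (t ⊗ s))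
  X·-⊗ t s = coeffwise λ i →
    trans (coeff-⊗-∷ 0# t s i) (trans (+-cong (zeroˡ _) refl) (+-identityˡ _))

  ⊗-assoc : ∀ p r s → (p ⊗ r) ⊗ s ≅ p ⊗ (r ⊗ s)
  ⊗-assoc []      r s = ≅-refl
  ⊗-assoc (a ∷ p) r s = begin
    (scale a r ⊕ (0# ∷ (p ⊗ r))) ⊗ s        ≈⟨ ⊗-distribʳ (scale a r) _ s ⟩
    scale a r ⊗ s ⊕ (0# ∷ (p ⊗ r)) ⊗ s     ≈⟨ ⊕-cong (scale-⊗ a r s) (X·-⊗ (p ⊗ r) s) ⟩
    scale a (r ⊗ s) ⊕ (0# ∷ ((p ⊗ r) ⊗ s)) ≈⟨ ⊕-congˡ (scale a (r ⊗ s)) (∷-cong refl (⊗-assoc p r s)) ⟩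
    scale a (r ⊗ s) ⊕ (0# ∷ (p ⊗ (r ⊗ s))) ∎
    where open ≅-Reasoning

  constant-⊗ : ∀ k p → (k ∷ []) ⊗ p ≅ scale k p
  constant-⊗ k p = coeffwise λ i →
    trans (coeff-⊕ (scale k p) (0# ∷ []) i) (trans (+-cong refl (X·0 i)) (+-identityʳ _))
    where
    X·0 : ∀ i → coeff (0# ∷ []) i ≈ 0#
    X·0 zero    = refl
    X·0 (suc i) = refl

  ⊗-identityˡ : ∀ p → 1ₚ ⊗ p ≅ p
  ⊗-identityˡ p =
    ≅-trans (constant-⊗ 1# p) (coeffwise λ i → trans (coeff-scale 1# p i) (*-identityˡ _))

  ⊗-distribˡ : ∀ p q r → p ⊗ (q ⊕ r) ≅ p ⊗ q ⊕ p ⊗ r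
  ⊗-distribˡ p q r =
    ≅-trans (⊗-comm p (q ⊕ r)) (≅-trans (⊗-distribʳ q r p) (⊕-cong (⊗-comm q p) (⊗-comm r p)))

  -- Polynomials over F, with coefficientwise equality, form a commutative
  -- ring; this makes the library's ring and group lemmas available (module R).

  polyRing : CommutativeRing c ℓ
  polyRing = record
    { Carrier = Pol ; _≈_ = _≅_ ; _+_ = _⊕_ ; _*_ = _⊗_ ; -_ = neg ; 0# = [] ; 1# = 1ₚ
    ; isCommutativeRing = record
      { isRing = record
        { +-isAbelianGroup = record
          { isGroup = record
            { isMonoid = record
              { isSemigroup = record
                { isMagma = record { isEquivalence = ≅-isEquivalence ; ∙-cong = ⊕-cong }
                ; assoc = ⊕-assoc }
              ; identity = (λ p → ≅-refl) , ⊕-identityʳ }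
            ; inverse = ⊕-inverseˡ , ⊕-inverseʳ
            ; ⁻¹-cong = neg-cong }
          ; comm = ⊕-comm }
        ; *-cong = ⊗-cong
        ; *-assoc = ⊗-assoc
        ; *-identity = ⊗-identityˡ , λ p → ≅-trans (⊗-comm p 1ₚ) (⊗-identityˡ p)
        ; distrib = ⊗-distribˡ , (λ r p q → ⊗-distribʳ p q r) }
      ; *-comm = ⊗-comm } }

  module R where
    open CommutativeRing polyRing public
    open RingProperties ring public
    open CommutativeSemigroupProperties (CommutativeRing.*-commutativeSemigroup polyRing) public
      using (x∙yz≈y∙xz)
    open CommutativeSemigroupProperties (CommutativeRing.+-commutativeSemigroup polyRing) public
      using () renaming (interchange to +-interchange)

  -- Degrees

  -- Every polynomial is 0 or has a degree (F has decidable zero).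
  zero-or-degree : ∀ p → (p ≅ 0ₚ) ⊎ (∃ λ d → HasDegree p d)
  zero-or-degree []      = inj₁ ≅-refl
  zero-or-degree (a ∷ p) with zero-or-degree p
  ... | inj₂ (d , top≉0 , above≈0) =
          inj₂ (suc d , top≉0 , λ { zero () ; (suc i) (s≤s d<i) → above≈0 i d<i })
  ... | inj₁ (coeffwise p≈0) with ≈0? a
  ...   | yes a≈0 = inj₁ (coeffwise λ { zero → a≈0 ; (suc i) → p≈0 i })
  ...   | no a≉0  = inj₂ (0 , a≉0 , λ { zero () ; (suc i) _ → p≈0 i })

  HasDegree-resp : ∀ {p r d} → HasDegree p d → p ≅ r → HasDegree r d
  HasDegree-resp {d = d} (top≉0 , above≈0) (coeffwise h) =
    (λ e → top≉0 (trans (h d) e)) , λ i d<i → trans (sym (h i)) (above≈0 i d<i)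

  degree-unique : ∀ {p d e} → HasDegree p d → HasDegree p e → d ≡.≡ e
  degree-unique {d = d} {e} (d-top , d-above) (e-top , e-above) with ℕ.<-cmp d e
  ... | tri< d<e _ _ = ⊥-elim (e-top (d-above e d<e))
  ... | tri≈ _ d≡e _ = d≡e
  ... | tri> _ _ e<d = ⊥-elim (d-top (e-above d e<d))

  HasDegree⇒≉0 : ∀ {p d} → HasDegree p d → ¬ (p ≅ 0ₚ)
  HasDegree⇒≉0 {d = d} (top≉0 , _) (coeffwise p≈0) = top≉0 (p≈0 d)

  HasDegree⇒< : ∀ {p d n} → HasDegree p d → DegLt p n → d < n
  HasDegree⇒< {d = d} {n} (top≉0 , _) p<n with n ≤? d
  ... | yes n≤d = ⊥-elim (top≉0 (p<n d n≤d))
  ... | no n≰d  = ℕ.≰⇒> n≰d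

  HasDegree⇒DegLt : ∀ {p d n} → HasDegree p d → d < n → DegLt p n
  HasDegree⇒DegLt (_ , above≈0) d<n i n≤i = above≈0 i (ℕ.<-≤-trans d<n n≤i)

  DegLt-mono : ∀ {p m n} → m ≤ n → DegLt p m → DegLt p n
  DegLt-mono m≤n p<m i n≤i = p<m i (ℕ.≤-trans m≤n n≤i)

  DegLt-length : ∀ p → DegLt p (length p)
  DegLt-length []      i       _         = refl
  DegLt-length (a ∷ p) (suc i) (s≤s n≤i) = DegLt-length p i n≤i

  DegLt-zero : ∀ {p} → DegLt p 0 → p ≅ 0ₚ
  DegLt-zero p<0 = coeffwise λ i → p<0 i z≤n

  zero⇒DegLt : ∀ {p n} → p ≅ 0ₚ → DegLt p n
  zero⇒DegLt (coeffwise p≈0) i _ = p≈0 i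

  HasDegree-scale : ∀ {x r d} → ¬ (x ≈ 0#) → HasDegree r d → HasDegree (scale x r) d
  HasDegree-scale {x} {r} {d} x≉0 (top≉0 , above≈0) =
    (λ e → *-nonzero x≉0 top≉0 (trans (sym (coeff-scale x r d)) e)) ,
    λ i d<i → trans (coeff-scale x r i) (trans (*-cong refl (above≈0 i d<i)) (zeroʳ x))

  -- deg (p·r) = deg p + deg r, because F has no zero divisors.
  HasDegree-⊗ : ∀ p r {a b} → HasDegree p a → HasDegree r b → HasDegree (p ⊗ r) (a + b)
  HasDegree-⊗ []      r (top≉0 , _) _ = ⊥-elim (top≉0 refl)
  HasDegree-⊗ (x ∷ p) r {zero} (x≉0 , above≈0) r-deg =
    HasDegree-resp (HasDegree-scale {x} {r} x≉0 r-deg)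
      (≅-sym (≅-trans (⊕-congˡ (scale x r) X·p⊗r≈0) (⊕-identityʳ (scale x r))))
    where
    X·p⊗r≈0 : (0# ∷ (p ⊗ r)) ≅ []
    X·p⊗r≈0 = ≅-trans (∷-cong refl (⊗-zeroˡ p r (coeffwise λ i → above≈0 (suc i) (s≤s z≤n))))
                      (coeffwise λ { zero → refl ; (suc i) → refl })
  HasDegree-⊗ (x ∷ p) r {suc a} {b} (top≉0 , above≈0) (r-top≉0 , r-above≈0) = top'≉0 , above'≈0
    where
    open ≈-Reasoning
    p⊗r-deg : HasDegree (p ⊗ r) (a + b)
    p⊗r-deg = HasDegree-⊗ p r (top≉0 , λ i a<i → above≈0 (suc i) (s≤s a<i)) (r-top≉0 , r-above≈0)
    x·r-above : ∀ i → b < i → x *F coeff r i ≈ 0#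
    x·r-above i b<i = trans (*-cong refl (r-above≈0 i b<i)) (zeroʳ x)
    b<1+a+b : b < suc (a + b)
    b<1+a+b = s≤s (ℕ.m≤n+m b a)
    top'≉0 : ¬ (coeff ((x ∷ p) ⊗ r) (suc (a + b)) ≈ 0#)
    top'≉0 e = proj₁ p⊗r-deg (begin
      coeff (p ⊗ r) (a + b)                                  ≈⟨ +-identityˡ _ ⟨
      0# +F coeff (p ⊗ r) (a + b)                            ≈⟨ +-cong (x·r-above _ b<1+a+b) refl ⟨
      x *F coeff r (suc (a + b)) +F coeff (p ⊗ r) (a + b)    ≈⟨ coeff-⊗-∷ x p r (suc (a + b)) ⟨
      coeff ((x ∷ p) ⊗ r) (suc (a + b))                      ≈⟨ e ⟩
      0#                                                     ∎)
    above'≈0 : ∀ i → suc (a + b) < i → coeff ((x ∷ p) ⊗ r) i ≈ 0#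
    above'≈0 (suc i) (s≤s a+b<i) = begin
      coeff ((x ∷ p) ⊗ r) (suc i)               ≈⟨ coeff-⊗-∷ x p r (suc i) ⟩
      x *F coeff r (suc i) +F coeff (p ⊗ r) i
        ≈⟨ +-cong (x·r-above _ (ℕ.<-trans b<1+a+b (s≤s a+b<i))) (proj₂ p⊗r-deg i a+b<i) ⟩
      0# +F 0#                                  ≈⟨ +-identityˡ 0# ⟩
      0#                                        ∎

  HasDegree-⊕ : ∀ {p s d} → HasDegree p d → DegLt s d → HasDegree (p ⊕ s) d
  HasDegree-⊕ {p} {s} {d} (top≉0 , above≈0) s<d =
    top≉0' , λ i d<i →
      trans (coeff-⊕ p s i) (trans (+-cong (above≈0 i d<i) (s<d i (ℕ.<⇒≤ d<i))) (+-identityˡ 0#))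
    where
    open ≈-Reasoning
    top≉0' : ¬ (coeff (p ⊕ s) d ≈ 0#)
    top≉0' e = top≉0 (begin
      coeff p d                ≈⟨ +-identityʳ _ ⟨
      coeff p d +F 0#          ≈⟨ +-cong refl (s<d d ℕ.≤-refl) ⟨
      coeff p d +F coeff s d   ≈⟨ coeff-⊕ p s d ⟨
      coeff (p ⊕ s) d          ≈⟨ e ⟩
      0#                       ∎)

  -- Cancellation, Euclidean division, Bézout and Gauss

  add-sub-cancel : ∀ x y z → (x ⊕ z) ⊕ (y ⊖ z) ≅ x ⊕ y
  add-sub-cancel x y z = begin
    (x ⊕ z) ⊕ (y ⊖ z)   ≈⟨ R.+-assoc x z (y ⊖ z) ⟩
    x ⊕ (z ⊕ (y ⊖ z))   ≈⟨ ⊕-congˡ x (≅-trans (≅-sym (R.+-assoc z y (neg z))) (R.xyx⁻¹≈y z y)) ⟩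
    x ⊕ y               ∎
    where open ≅-Reasoning

  sub-add-cancel : ∀ x y z → (x ⊕ z) ⊖ (y ⊕ z) ≅ x ⊖ y
  sub-add-cancel x y z = begin
    (x ⊕ z) ⊕ neg (y ⊕ z)           ≈⟨ ⊕-congˡ (x ⊕ z) (R.-‿+-comm y z) ⟨
    (x ⊕ z) ⊕ (neg y ⊕ neg z)       ≈⟨ R.+-interchange x z (neg y) (neg z) ⟩
    (x ⊖ y) ⊕ (z ⊖ z)               ≈⟨ ⊕-congˡ (x ⊖ y) (⊕-inverseʳ z) ⟩
    (x ⊖ y) ⊕ []                    ≈⟨ ⊕-identityʳ (x ⊖ y) ⟩
    x ⊖ y                           ∎
    where open ≅-Reasoning

  ⊗-cancelˡ : ∀ Q {dQ x y} → HasDegree Q dQ → Q ⊗ x ≅ Q ⊗ y → x ≅ y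
  ⊗-cancelˡ Q {x = x} {y} Q-deg Qx≅Qy with zero-or-degree (x ⊖ y)
  ... | inj₁ x-y≅0          = R.x∙y⁻¹≈ε⇒x≈y x y x-y≅0
  ... | inj₂ (d , x-y-deg) = ⊥-elim (HasDegree⇒≉0 (HasDegree-⊗ Q (x ⊖ y) Q-deg x-y-deg)
                                (≅-trans (R.x[y-z]≈xy-xz Q x y) (R.x≈y⇒x∙y⁻¹≈ε Qx≅Qy)))

  -- Writing
  -- A = a + X·A' and A' = q'·B + r', the polynomial t = a + X·r' has
  -- degree ≤ dB; subtracting the right multiple k·B of B kills its
  -- coefficient at dB.
  divMod : ∀ {B dB} → HasDegree B dB → ∀ A →
           Σ Pol λ q → Σ Pol λ r → (A ≅ q ⊗ B ⊕ r) × DegLt r dB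
  divMod hB [] = [] , [] , ≅-refl , (λ i _ → refl)
  divMod {B} {dB} hB (a ∷ A') with divMod hB A' | inverse (coeff B dB) (proj₁ hB)
  ... | q' , r' , A'≅q'B+r' , r'<dB | β⁻¹ , ββ⁻¹≈1 = q , t ⊖ scale k B , A≅qB+r , r<dB
    where
    t : Pol
    t = a ∷ r'
    k : Carrier
    k = coeff t dB *F β⁻¹
    q : Pol
    q = (0# ∷ q') ⊕ (k ∷ [])

    kβ≈t : k *F coeff B dB ≈ coeff t dB
    kβ≈t = begin
      (coeff t dB *F β⁻¹) *F coeff B dB   ≈⟨ *-assoc _ β⁻¹ _ ⟩
      coeff t dB *F (β⁻¹ *F coeff B dB)   ≈⟨ *-cong refl (trans (*-comm β⁻¹ _) ββ⁻¹≈1) ⟩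
      coeff t dB *F 1#                    ≈⟨ *-identityʳ _ ⟩
      coeff t dB                          ∎
      where open ≈-Reasoning

    t≈kB : ∀ i → dB ≤ i → coeff t i ≈ coeff (scale k B) i
    t≈kB i dB≤i with ℕ.m≤n⇒m<n∨m≡n dB≤i
    ... | inj₂ ≡.refl = sym (trans (coeff-scale k B dB) kβ≈t)
    ... | inj₁ dB<i = trans (t<1+dB i dB<i)
          (sym (trans (coeff-scale k B i) (trans (*-cong refl (proj₂ hB i dB<i)) (zeroʳ k))))
      where
      t<1+dB : DegLt t (suc dB)
      t<1+dB (suc j) (s≤s dB≤j) = r'<dB j dB≤j

    r<dB : DegLt (t ⊖ scale k B) dB
    r<dB i dB≤i = trans (coeff-⊖ t (scale k B) i) (x≈y⇒x∙y⁻¹≈ε (t≈kB i dB≤i))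

    A≅qB+r : (a ∷ A') ≅ q ⊗ B ⊕ (t ⊖ scale k B)
    A≅qB+r = begin
      a ∷ A'                                             ≈⟨ ∷-cong (sym (+-identityˡ a)) A'≅q'B+r' ⟩
      (0# ∷ (q' ⊗ B)) ⊕ t                                ≈⟨ add-sub-cancel (0# ∷ (q' ⊗ B)) t (scale k B) ⟨
      ((0# ∷ (q' ⊗ B)) ⊕ scale k B) ⊕ (t ⊖ scale k B)    ≈⟨ ⊕-congʳ (t ⊖ scale k B) qB ⟨
      q ⊗ B ⊕ (t ⊖ scale k B)                            ∎
      where
      open ≅-Reasoning
      qB : q ⊗ B ≅ (0# ∷ (q' ⊗ B)) ⊕ scale k B
      qB = ≅-trans (⊗-distribʳ (0# ∷ q') (k ∷ []) B) (⊕-cong (X·-⊗ q' B) (constant-⊗ k B))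

  BezoutIdentity : Pol → Pol → Set (c ⊔ ℓ)
  BezoutIdentity A B = Σ Pol λ a → Σ Pol λ b → a ⊗ A ⊕ b ⊗ B ≅ 1ₚ

  -- If B = 0, then A divides both A and B, so A is a nonzero constant α,
  -- and α⁻¹·A = 1.
  bezout-zero : ∀ A B → B ≅ 0ₚ → Coprime A B → BezoutIdentity A B
  bezout-zero A B B≅0 coprime
    with coprime A (1ₚ , coeff≈ (R.*-identityʳ A)) ([] , coeff≈ (≅-trans (R.zeroʳ A) (≅-sym B≅0)))
  ... | α≉0 , above≈0 with inverse (coeff A 0) α≉0
  ...   | α⁻¹ , αα⁻¹≈1 =
          (α⁻¹ ∷ []) , [] , ≅-trans (⊕-identityʳ _) (≅-trans (constant-⊗ α⁻¹ A) (coeffwise α⁻¹A≈1))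
    where
    α⁻¹A≈1 : ∀ i → coeff (scale α⁻¹ A) i ≈ coeff 1ₚ i
    α⁻¹A≈1 zero    = trans (coeff-scale α⁻¹ A 0) (trans (*-comm α⁻¹ _) αα⁻¹≈1)
    α⁻¹A≈1 (suc i) = trans (coeff-scale α⁻¹ A (suc i))
                           (trans (*-cong refl (above≈0 (suc i) (s≤s z≤n))) (zeroʳ α⁻¹))

  -- A common divisor of B and r divides A = q·B + r.
  coprime-remainder : ∀ {A B q r} → A ≅ q ⊗ B ⊕ r → Coprime A B → Coprime B r
  coprime-remainder {A} {B} {q} {r} A≅qB+r coprime D (s , Ds≃B) (t , Dt≃r) =
    coprime D (q ⊗ s ⊕ t , coeff≈ D∣A) (s , Ds≃B)
    where
    open ≅-Reasoning
    D∣A : D ⊗ (q ⊗ s ⊕ t) ≅ A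
    D∣A = begin
      D ⊗ (q ⊗ s ⊕ t)       ≈⟨ R.distribˡ D (q ⊗ s) t ⟩
      D ⊗ (q ⊗ s) ⊕ D ⊗ t   ≈⟨ ⊕-congʳ (D ⊗ t) (R.x∙yz≈y∙xz D q s) ⟩
      q ⊗ (D ⊗ s) ⊕ D ⊗ t   ≈⟨ ⊕-cong (⊗-congʳ q (coeffwise Ds≃B)) (coeffwise Dt≃r) ⟩
      q ⊗ B ⊕ r             ≈⟨ A≅qB+r ⟨
      A                     ∎

  -- Euclid's algorithm, by induction on a bound n for the degree of B:
  -- from a'·B + b'·r = 1 and A = q·B + r we get b'·A + (a' − b'·q)·B = 1.
  coprime⇒bezout-bounded : ∀ n A B → DegLt B n → Coprime A B → BezoutIdentity A B
  coprime⇒bezout-bounded zero    A B B<0 coprime = bezout-zero A B (DegLt-zero B<0) coprime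
  coprime⇒bezout-bounded (suc n) A B B<n coprime with zero-or-degree B
  ... | inj₁ B≅0 = bezout-zero A B B≅0 coprime
  ... | inj₂ (d , B-deg) with divMod B-deg A | HasDegree⇒< {B} B-deg B<n
  ...   | q , r , A≅qB+r , r<d | s≤s d≤n
    with coprime⇒bezout-bounded n B r (DegLt-mono {r} d≤n r<d)
                                      (coprime-remainder {A} {B} {q} {r} A≅qB+r coprime)
  ...     | a' , b' , a'B+b'r≅1 = b' , a' ⊖ b' ⊗ q , (begin
    b' ⊗ A ⊕ (a' ⊖ b' ⊗ q) ⊗ B
      ≈⟨ ⊕-cong (⊗-congʳ b' A≅qB+r) (R.[y-z]x≈yx-zx B a' (b' ⊗ q)) ⟩
    b' ⊗ (q ⊗ B ⊕ r) ⊕ (a' ⊗ B ⊖ (b' ⊗ q) ⊗ B)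
      ≈⟨ ⊕-congʳ (a' ⊗ B ⊖ (b' ⊗ q) ⊗ B)
           (≅-trans (R.distribˡ b' (q ⊗ B) r) (R.+-comm (b' ⊗ (q ⊗ B)) (b' ⊗ r))) ⟩
    (b' ⊗ r ⊕ b' ⊗ (q ⊗ B)) ⊕ (a' ⊗ B ⊖ (b' ⊗ q) ⊗ B)
      ≈⟨ ⊕-congʳ (a' ⊗ B ⊖ (b' ⊗ q) ⊗ B) (⊕-congˡ (b' ⊗ r) (R.*-assoc b' q B)) ⟨
    (b' ⊗ r ⊕ (b' ⊗ q) ⊗ B) ⊕ (a' ⊗ B ⊖ (b' ⊗ q) ⊗ B)
      ≈⟨ add-sub-cancel (b' ⊗ r) (a' ⊗ B) ((b' ⊗ q) ⊗ B) ⟩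
    b' ⊗ r ⊕ a' ⊗ B
      ≈⟨ ≅-trans (R.+-comm (b' ⊗ r) (a' ⊗ B)) a'B+b'r≅1 ⟩
    1ₚ ∎)
    where open ≅-Reasoning

  coprime⇒bezout : ∀ A B → Coprime A B → BezoutIdentity A B
  coprime⇒bezout A B = coprime⇒bezout-bounded (length B) A B (DegLt-length B)

  -- Gauss's lemma: if Q·g = P·y with P, Q coprime, then Q divides y;
  -- explicitly, y = Q·(a·g + b·y) for a·P + b·Q = 1.
  gauss : ∀ {P Q} → BezoutIdentity P Q → ∀ g y → Q ⊗ g ≅ P ⊗ y → Σ Pol λ f → Q ⊗ f ≅ y
  gauss {P} {Q} (a , b , aP+bQ≅1) g y Qg≅Py = a ⊗ g ⊕ b ⊗ y , (begin
    Q ⊗ (a ⊗ g ⊕ b ⊗ y)          ≈⟨ R.distribˡ Q _ _ ⟩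
    Q ⊗ (a ⊗ g) ⊕ Q ⊗ (b ⊗ y)    ≈⟨ ⊕-cong (R.x∙yz≈y∙xz Q a g) (R.x∙yz≈y∙xz Q b y) ⟩
    a ⊗ (Q ⊗ g) ⊕ b ⊗ (Q ⊗ y)    ≈⟨ ⊕-congʳ (b ⊗ (Q ⊗ y)) (⊗-congʳ a Qg≅Py) ⟩
    a ⊗ (P ⊗ y) ⊕ b ⊗ (Q ⊗ y)    ≈⟨ ⊕-cong (R.*-assoc a P y) (R.*-assoc b Q y) ⟨
    (a ⊗ P) ⊗ y ⊕ (b ⊗ Q) ⊗ y    ≈⟨ R.distribʳ y (a ⊗ P) (b ⊗ Q) ⟨
    (a ⊗ P ⊕ b ⊗ Q) ⊗ y          ≈⟨ ⊗-congˡ y aP+bQ≅1 ⟩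
    1ₚ ⊗ y                       ≈⟨ ⊗-identityˡ y ⟩
    y                            ∎)
    where open ≅-Reasoning

module ExpansionGraph {c ℓ} (F : FiniteField c ℓ) where
  open Polynomials F

  -- Descent: the homogeneous recurrence Q·eₘ₊₁ = P·eₘ, with P and Q coprime
  -- and deg Q ≥ 1, has only solutions with e₀ = 0.  Each eₘ is Q·fₘ
  -- (Gauss), the fₘ solve the same recurrence (cancel Q), and
  -- deg f₀ < deg e₀; induct on a bound for deg e₀.
  module Descent {P Q dQ} (bezout : BezoutIdentity P Q) (Q-deg : HasDegree Q dQ) (1≤dQ : 1 ≤ dQ)
    where

    quotient-DegLt : ∀ {f e k} → Q ⊗ f ≅ e → DegLt e (suc k) → DegLt f k
    quotient-DegLt {f} {e} {k} Qf≅e e<1+k with zero-or-degree f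
    ... | inj₁ f≅0 = zero⇒DegLt {f} f≅0
    ... | inj₂ (d , f-deg) = HasDegree⇒DegLt {f} f-deg (ℕ.≤-trans (ℕ.+-monoˡ-≤ d 1≤dQ) dQ+d≤k)
      where
      dQ+d≤k : dQ + d ≤ k
      dQ+d≤k = ℕ.≤-pred (HasDegree⇒< {e} (HasDegree-resp (HasDegree-⊗ Q f Q-deg f-deg) Qf≅e) e<1+k)

    descent-bounded : ∀ k (e : ℕ → Pol) → (∀ m → Q ⊗ e (suc m) ≅ P ⊗ e m) →
                      DegLt (e 0) k → e 0 ≅ 0ₚ
    descent-bounded zero    e recurrence e₀<0 = DegLt-zero {e 0} e₀<0
    descent-bounded (suc k) e recurrence e₀<1+k = begin
      e 0        ≈⟨ Qf≅e 0 ⟨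
      Q ⊗ f 0    ≈⟨ ⊗-congʳ Q (descent-bounded k f f-recurrence (quotient-DegLt (Qf≅e 0) e₀<1+k)) ⟩
      Q ⊗ 0ₚ     ≈⟨ R.zeroʳ Q ⟩
      0ₚ         ∎
      where
      open ≅-Reasoning
      quotient : ∀ m → Σ Pol λ f → Q ⊗ f ≅ e m
      quotient m = gauss bezout (e (suc m)) (e m) (recurrence m)
      f : ℕ → Pol
      f m = proj₁ (quotient m)
      Qf≅e : ∀ m → Q ⊗ f m ≅ e m
      Qf≅e m = proj₂ (quotient m)
      f-recurrence : ∀ m → Q ⊗ f (suc m) ≅ P ⊗ f m
      f-recurrence m = ⊗-cancelˡ Q Q-deg (begin
        Q ⊗ (Q ⊗ f (suc m))   ≈⟨ ⊗-congʳ Q (Qf≅e (suc m)) ⟩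
        Q ⊗ e (suc m)         ≈⟨ recurrence m ⟩
        P ⊗ e m               ≈⟨ ⊗-congʳ P (Qf≅e m) ⟨
        P ⊗ (Q ⊗ f m)         ≈⟨ R.x∙yz≈y∙xz P Q (f m) ⟩
        Q ⊗ (P ⊗ f m)         ∎)

    descent : (e : ℕ → Pol) → (∀ m → Q ⊗ e (suc m) ≅ P ⊗ e m) → e 0 ≅ 0ₚ
    descent e recurrence = descent-bounded (length (e 0)) e recurrence (DegLt-length (e 0))

  module Path {P Q dP dQ} (P-deg : HasDegree P dP) (Q-deg : HasDegree Q dQ) (dQ<dP : dQ < dP)
              (w v : ℕ → Pol) (digits : ∀ n → Digit dP (w n))
              (edge : ∀ n → Q ⊗ v (suc n) ≅ P ⊗ v n ⊕ w n) where

    edge-degree : ∀ n {d} → HasDegree (v n) d → HasDegree (P ⊗ v n ⊕ w n) (dP + d)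
    edge-degree n {d} vₙ-deg = HasDegree-⊕ {P ⊗ v n} {w n}
      (HasDegree-⊗ P (v n) P-deg vₙ-deg) (DegLt-mono {w n} (ℕ.m≤m+n dP d) (digits n))

    -- Growth: a nonzero vertex is followed by a nonzero vertex of larger
    -- degree, since dQ + deg vₙ₊₁ = dP + deg vₙ and dQ < dP.
    degree-grows : ∀ n {d} → HasDegree (v n) d → Σ ℕ λ d' → HasDegree (v (suc n)) d' × d < d'
    degree-grows n {d} vₙ-deg with zero-or-degree (v (suc n))
    ... | inj₁ vₙ₊₁≅0 = ⊥-elim (HasDegree⇒≉0 {P ⊗ v n ⊕ w n} (edge-degree n vₙ-deg)
                          (≅-trans (≅-sym (edge n)) (≅-trans (⊗-congʳ Q vₙ₊₁≅0) (R.zeroʳ Q))))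
    ... | inj₂ (d' , vₙ₊₁-deg) = d' , vₙ₊₁-deg , d<d'
      where
      dQ+d'≡dP+d : dQ + d' ≡.≡ dP + d
      dQ+d'≡dP+d = degree-unique {P ⊗ v n ⊕ w n}
        (HasDegree-resp (HasDegree-⊗ Q (v (suc n)) Q-deg vₙ₊₁-deg) (edge n)) (edge-degree n vₙ-deg)
      d<d' : d < d'
      d<d' with d' ≤? d
      ... | yes d'≤d = ⊥-elim (ℕ.<-irrefl dQ+d'≡dP+d (ℕ.+-mono-<-≤ dQ<dP d'≤d))
      ... | no d'≰d  = ℕ.≰⇒> d'≰d

    degree-grows-after : ∀ k n {d} → HasDegree (v n) d →
                         Σ ℕ λ d' → HasDegree (v (suc k + n)) d' × d < d'
    degree-grows-after zero    n vₙ-deg = degree-grows n vₙ-deg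
    degree-grows-after (suc k) n vₙ-deg with degree-grows-after k n vₙ-deg
    ... | d₁ , later-deg , d<d₁ with degree-grows (suc k + n) later-deg
    ...   | d₂ , next-deg , d₁<d₂ = d₂ , next-deg , ℕ.<-trans d<d₁ d₁<d₂

    difference-recurrence : ∀ a b → (∀ m → w (m + a) ≅ w (m + b)) →
      ∀ m → Q ⊗ (v (suc m + a) ⊖ v (suc m + b)) ≅ P ⊗ (v (m + a) ⊖ v (m + b))
    difference-recurrence a b same-labels m = begin
      Q ⊗ (v (suc m + a) ⊖ v (suc m + b))
        ≈⟨ R.x[y-z]≈xy-xz Q _ _ ⟩
      Q ⊗ v (suc m + a) ⊖ Q ⊗ v (suc m + b)
        ≈⟨ ⊕-cong (edge (m + a)) (neg-cong (edge (m + b))) ⟩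
      (P ⊗ v (m + a) ⊕ w (m + a)) ⊖ (P ⊗ v (m + b) ⊕ w (m + b))
        ≈⟨ ⊕-congʳ _ (⊕-congˡ (P ⊗ v (m + a)) (same-labels m)) ⟩
      (P ⊗ v (m + a) ⊕ w (m + b)) ⊖ (P ⊗ v (m + b) ⊕ w (m + b))
        ≈⟨ sub-add-cancel (P ⊗ v (m + a)) (P ⊗ v (m + b)) (w (m + b)) ⟩
      P ⊗ v (m + a) ⊖ P ⊗ v (m + b)
        ≈⟨ R.x[y-z]≈xy-xz P _ _ ⟨
      P ⊗ (v (m + a) ⊖ v (m + b))
        ∎
      where open ≅-Reasoning

    module _ (bezout : BezoutIdentity P Q) (1≤dQ : 1 ≤ dQ) (N k : ℕ)
             (periodic : ∀ n → N ≤ n → w (n + suc k) ≅ w n) where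
      open Descent bezout Q-deg 1≤dQ

      -- Where the labels are periodic, with period p = 1 + k, the vertices
      -- vanish: the stretches starting at p + M and at M carry the same
      -- labels, so v_{p+M} = v_M by descent, which growth forbids unless v_M = 0.
      periodic-part-vanishes : ∀ M → N ≤ M → v M ≅ 0ₚ
      periodic-part-vanishes M N≤M with zero-or-degree (v M)
      ... | inj₁ v≅0 = v≅0
      ... | inj₂ (d , v-deg) with degree-grows-after k M v-deg
      ...   | d' , later-deg , d<d' =
              ⊥-elim (ℕ.<-irrefl (degree-unique {v M} v-deg (HasDegree-resp later-deg returns)) d<d')
        where
        same-labels : ∀ m → w (m + (suc k + M)) ≅ w (m + M)
        same-labels m = ≅-trans (≅-reflexive (≡.cong w shift))
                                (periodic (m + M) (ℕ.≤-trans N≤M (ℕ.m≤n+m M m)))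
          where
          shift : m + (suc k + M) ≡.≡ (m + M) + suc k
          shift = ≡.trans (≡.cong (m +_) (ℕ.+-comm (suc k) M)) (≡.sym (ℕ.+-assoc m M (suc k)))
        returns : v (suc k + M) ≅ v M
        returns = R.x∙y⁻¹≈ε⇒x≈y _ _ (descent (λ m → v (m + (suc k + M)) ⊖ v (m + M))
                                             (difference-recurrence (suc k + M) M same-labels))

      -- Growth carries a nonzero vertex into the periodic part.
      vertices-vanish : ∀ n → v n ≅ 0ₚ
      vertices-vanish n with zero-or-degree (v n)
      ... | inj₁ v≅0 = v≅0
      ... | inj₂ (d , v-deg) with degree-grows-after N n v-deg
      ...   | d' , later-deg , _ = ⊥-elim (HasDegree⇒≉0 {v (suc N + n)} later-deg
              (periodic-part-vanishes (suc N + n) (ℕ.≤-trans (ℕ.n≤1+n N) (ℕ.m≤m+n (suc N) n))))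

      digits-vanish : ∀ n → w n ≅ 0ₚ
      digits-vanish n = begin
        w n             ≈⟨ ⊕-congʳ (w n) (≅-trans (⊗-congʳ P (vertices-vanish n)) (R.zeroʳ P)) ⟨
        P ⊗ v n ⊕ w n   ≈⟨ edge n ⟨
        Q ⊗ v (suc n)   ≈⟨ ⊗-congʳ Q (vertices-vanish (suc n)) ⟩
        Q ⊗ 0ₚ          ≈⟨ R.zeroʳ Q ⟩
        0ₚ              ∎
        where open ≅-Reasoning

theorem4p7 : ∀ {c ℓ} (F : FiniteField c ℓ) → let open Poly F in
    (P Q : Pol) (dP dQ : ℕ) → HasDegree P dP → HasDegree Q dQ →
    Coprime P Q → dQ < dP → 1 ≤ dQ →
    (w : ℕ → Pol) → InW P Q dP w → EventuallyPeriodic w → IsZeroWord w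
-- The period is positive, so it has the form 1 + k.
theorem4p7 F P Q dP dQ P-deg Q-deg coprime dQ<dP 1≤dQ w _ (_ , zero , () , _)
theorem4p7 F P Q dP dQ P-deg Q-deg coprime dQ<dP 1≤dQ w
           (digits , v , _ , edge) (N , suc k , _ , periodic) n =
  coeff≈ (digits-vanish (coprime⇒bezout P Q coprime) 1≤dQ N k
                        (λ m N≤m → coeffwise (periodic m N≤m)) n)
  where
  open Polynomials F
  open ExpansionGraph.Path F {P} {Q} P-deg Q-deg dQ<dP w v digits (λ m → coeffwise (edge m))
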